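{- For any finite set $\mathcal E$ of correct equations between microCCS terms, there exist microCCS processes $P$ and $Q$ such that $P\sim Q$ but $P=Q$ is not derivable in equational logic from $\mathcal E$.
   Context: Fix an infinite set of names. MicroCCS processes: $\eta ::= a\mid\overline a$, $P::=\mathbf 0\mid \eta.P\mid P|Q$. Transitions: $\eta.P\xrightarrow{\eta}P$; if $P\xrightarrow{\eta}P'$, $Q\xrightarrow{\overline\eta}Q'$ then $P|Q\xrightarrow{\tau}P'|Q'$; if $P\xrightarrow{\mu}P'$ then $P|Q\xrightarrow{\mu}P'|Q$ and $Q|P\xrightarrow{\mu}Q|P'$ ($\mu$ is $\eta$ or $\tau$). Strong bisimilarity $\sim$ is the union of all symmetric relations $\mathcal R$ such that $P\mathcal RQ$, $P\xrightarrow{\mu}P'$ imply $Q\xrightarrow{\mu}Q'$ with $P'\mathcal RQ'$. MicroCCS terms with variables are given by $M::=\mathbf 0\mid\eta.M\mid M|M\mid X$ ($X$ ranging over variables); ground terms are terms without variables (i.e. processes). An equation is a pair $M=N$ of terms; it is correct if for every instantiation $\rho$ mapping variables to ground terms, $M\rho\sim N\rho$. Derivability from a set of equations $\mathcal E$ is in equational logic (reflexivity, symmetry, transitivity, closure under contexts and under instantiation of equations of $\mathcal E$). -}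

module Defs where

open import Data.Nat using (ℕ)
open import Data.Product using (Σ; _×_; _,_)
open import Data.List using (List)
open import Data.List.Membership.Propositional using (_∈_)
open import Level using (0ℓ; suc)

Name : Set
Name = ℕ

Var : Set
Var = ℕ

data Prefix : Set where
  nm  : Name → Prefix
  co  : Name → Prefix

bar : Prefix → Prefix
bar (nm a) = co a
bar (co a) = nm a

data Act : Set where
  vis : Prefix → Act
  τ   : Act

data Proc : Set where
  𝟎    : Proc
  _∙_  : Prefix → Proc → Proc
  _∣_  : Proc → Proc → Proc

infixr 6 _∙_
infixl 5 _∣_

data _─[_]→_ : Proc → Act → Proc → Set where
  pre  : ∀ {η P} → (η ∙ P) ─[ vis η ]→ P
  com  : ∀ {η P P' Q Q'} → P ─[ vis η ]→ P' → Q ─[ vis (bar η) ]→ Q' →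
         (P ∣ Q) ─[ τ ]→ (P' ∣ Q')
  parL : ∀ {μ P P' Q} → P ─[ μ ]→ P' → (P ∣ Q) ─[ μ ]→ (P' ∣ Q)
  parR : ∀ {μ P P' Q} → P ─[ μ ]→ P' → (Q ∣ P) ─[ μ ]→ (Q ∣ P')

Rel : Set₁
Rel = Proc → Proc → Set

IsSymBisim : Rel → Set
IsSymBisim R =
  (∀ {P Q} → R P Q → R Q P) ×
  (∀ {P Q μ P'} → R P Q → P ─[ μ ]→ P' → Σ Proc λ Q' → (Q ─[ μ ]→ Q') × R P' Q')

_∼_ : Proc → Proc → Set₁
P ∼ Q = Σ Rel λ R → IsSymBisim R × R P Q

data Term : Set where
  𝟎ₜ   : Term
  _∙ₜ_ : Prefix → Term → Term
  _∣ₜ_ : Term → Term → Term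
  var  : Var → Term

⌜_⌝ : Proc → Term
⌜ 𝟎 ⌝ = 𝟎ₜ
⌜ η ∙ P ⌝ = η ∙ₜ ⌜ P ⌝
⌜ P ∣ Q ⌝ = ⌜ P ⌝ ∣ₜ ⌜ Q ⌝

inst : Term → (Var → Proc) → Proc
inst 𝟎ₜ ρ = 𝟎
inst (η ∙ₜ M) ρ = η ∙ inst M ρ
inst (M ∣ₜ N) ρ = inst M ρ ∣ inst N ρ
inst (var X) ρ = ρ X

subst : Term → (Var → Term) → Term
subst 𝟎ₜ σ = 𝟎ₜ
subst (η ∙ₜ M) σ = η ∙ₜ subst M σ
subst (M ∣ₜ N) σ = subst M σ ∣ₜ subst N σ
subst (var X) σ = σ X

Equation : Set
Equation = Term × Term

Correct : Equation → Set₁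
Correct (M , N) = ∀ (ρ : Var → Proc) → inst M ρ ∼ inst N ρ

data _⊢_≈_ (ℰ : List Equation) : Term → Term → Set where
  refl  : ∀ {M} → ℰ ⊢ M ≈ M
  sym   : ∀ {M N} → ℰ ⊢ M ≈ N → ℰ ⊢ N ≈ M
  trans : ∀ {M N L} → ℰ ⊢ M ≈ N → ℰ ⊢ N ≈ L → ℰ ⊢ M ≈ L
  ctx-pre : ∀ {η M N} → ℰ ⊢ M ≈ N → ℰ ⊢ (η ∙ₜ M) ≈ (η ∙ₜ N)
  ctx-par : ∀ {M M' N N'} → ℰ ⊢ M ≈ M' → ℰ ⊢ N ≈ N' → ℰ ⊢ (M ∣ₜ N) ≈ (M' ∣ₜ N')
  ax    : ∀ {M N} → (M , N) ∈ ℰ → (σ : Var → Term) → ℰ ⊢ subst M σ ≈ subst N σ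

{-# OPTIONS --safe #-}
module Submission where

-- Pick a name b occurring in no equation of ℰ, and let pad replace every prefix b.P by b.b̄.P.
-- Whether a process can perform b, and whether it can perform b twice in a row, are preserved
-- by bisimilarity and determined compositionally, so "pad P and pad Q agree on these two
-- observations" is a congruence. As pad commutes with instantiating terms free of b, this
-- congruence validates every correct equation of ℰ, hence everything derivable from ℰ.
-- But b.b.0 ∼ b.0 | b.0, and only the latter pads to a process that can perform b twice in a row.

open import Defs
open import Data.Bool using (Bool; true; false; T; _∨_; _∧_; if_then_else_)
open import Data.Bool.Properties using (T-≡; T-∨; T-∧; ¬-not)
open import Data.List using (List; map)
open import Data.List.Extrema.Nat using (max; xs≤max)
open import Data.List.Relation.Unary.All as All using (All)
open import Data.List.Relation.Unary.All.Properties using (map⁻)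
open import Data.Nat using (ℕ; suc; _⊔_; _<_; _≡ᵇ_; s≤s)
open import Data.Nat.Properties using (<⇒≢; ≡⇒≡ᵇ; ≡ᵇ⇒≡; m⊔n<o⇒m<o; m⊔n<o⇒n<o)
open import Data.Product using (Σ; ∃; ∃₂; _×_; _,_; proj₂; uncurry)
open import Data.Empty using (⊥-elim)
open import Data.Sum using (inj₁; inj₂)
open import Function using (_∘_; _on_; Equivalence)
open import Relation.Binary.Construct.Closure.Symmetric using (SymClosure; fwd; bwd; symmetric)
import Relation.Binary.Construct.On as On
open import Relation.Binary.Structures using (IsEquivalence)
open import Relation.Binary.PropositionalEquality as ≡ using (_≡_; refl; cong; cong₂; subst₂)
open import Relation.Nullary using (¬_)

open Equivalence using (to; from)

record IsCongruence (_≃_ : Rel) : Set where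
  field
    isEquivalence : IsEquivalence _≃_
    ∙-cong : ∀ η {P Q} → P ≃ Q → (η ∙ P) ≃ (η ∙ Q)
    ∣-cong : ∀ {P P′ Q Q′} → P ≃ P′ → Q ≃ Q′ → (P ∣ Q) ≃ (P′ ∣ Q′)

  open IsEquivalence isEquivalence public

_⊨_ : Rel → Equation → Set
R ⊨ (M , N) = ∀ ρ → R (inst M ρ) (inst N ρ)

inst-subst : ∀ M σ ρ → inst (subst M σ) ρ ≡ inst M (λ X → inst (σ X) ρ)
inst-subst 𝟎ₜ σ ρ = refl
inst-subst (η ∙ₜ M) σ ρ = cong (η ∙_) (inst-subst M σ ρ)
inst-subst (M ∣ₜ N) σ ρ = cong₂ _∣_ (inst-subst M σ ρ) (inst-subst N σ ρ)
inst-subst (var X) σ ρ = refl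

inst-⌜⌝ : ∀ P ρ → inst ⌜ P ⌝ ρ ≡ P
inst-⌜⌝ 𝟎 ρ = refl
inst-⌜⌝ (η ∙ P) ρ = cong (η ∙_) (inst-⌜⌝ P ρ)
inst-⌜⌝ (P ∣ Q) ρ = cong₂ _∣_ (inst-⌜⌝ P ρ) (inst-⌜⌝ Q ρ)

module _ {R : Rel} (R-cong : IsCongruence R) where
  open IsCongruence R-cong using (∙-cong; ∣-cong)
    renaming (refl to R-refl; sym to R-sym; trans to R-trans)

  ⊢-sound : ∀ {ℰ M N} → All (R ⊨_) ℰ → ℰ ⊢ M ≈ N → R ⊨ (M , N)
  ⊢-sound ⊨ℰ refl ρ = R-refl
  ⊢-sound ⊨ℰ (sym d) ρ = R-sym (⊢-sound ⊨ℰ d ρ)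
  ⊢-sound ⊨ℰ (trans d e) ρ = R-trans (⊢-sound ⊨ℰ d ρ) (⊢-sound ⊨ℰ e ρ)
  ⊢-sound ⊨ℰ (ctx-pre {η} d) ρ = ∙-cong η (⊢-sound ⊨ℰ d ρ)
  ⊢-sound ⊨ℰ (ctx-par d e) ρ = ∣-cong (⊢-sound ⊨ℰ d ρ) (⊢-sound ⊨ℰ e ρ)
  ⊢-sound ⊨ℰ (ax {M} {N} M≈N∈ℰ σ) ρ
    rewrite inst-subst M σ ρ | inst-subst N σ ρ = All.lookup ⊨ℰ M≈N∈ℰ (λ X → inst (σ X) ρ)

  ⊢-sound-ground : ∀ {ℰ P Q} → All (R ⊨_) ℰ → ℰ ⊢ ⌜ P ⌝ ≈ ⌜ Q ⌝ → R P Q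
  ⊢-sound-ground {P = P} {Q} ⊨ℰ d =
    subst₂ R (inst-⌜⌝ P ρ) (inst-⌜⌝ Q ρ) (⊢-sound ⊨ℰ d ρ)
    where
    ρ : Var → Proc
    ρ _ = 𝟎

T-injective : ∀ {x y} → (T x → T y) → (T y → T x) → x ≡ y
T-injective {false} {false} _ _ = refl
T-injective {false} {true} _ y⇒x = ⊥-elim (y⇒x _)
T-injective {true} {false} x⇒y _ = ⊥-elim (x⇒y _)
T-injective {true} {true} _ _ = refl

∼-sym : ∀ {P Q} → P ∼ Q → Q ∼ P
∼-sym (R , (R-sym , R-sim) , PRQ) = R , (R-sym , R-sim) , R-sym PRQ

data SequentialParallel (a : Name) : Rel where
  aa,a∣a : SequentialParallel a (nm a ∙ nm a ∙ 𝟎) (nm a ∙ 𝟎 ∣ nm a ∙ 𝟎)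
  a,0∣a  : SequentialParallel a (nm a ∙ 𝟎) (𝟎 ∣ nm a ∙ 𝟎)
  a,a∣0  : SequentialParallel a (nm a ∙ 𝟎) (nm a ∙ 𝟎 ∣ 𝟎)
  0,0∣0  : SequentialParallel a 𝟎 (𝟎 ∣ 𝟎)

a∙a∼a∣a : ∀ a → (nm a ∙ nm a ∙ 𝟎) ∼ (nm a ∙ 𝟎 ∣ nm a ∙ 𝟎)
a∙a∼a∣a a = SymClosure (SequentialParallel a) , (symmetric _ , simulate) , fwd aa,a∣a
  where
  simulate : ∀ {P Q μ P′} → SymClosure (SequentialParallel a) P Q → P ─[ μ ]→ P′ →
             Σ Proc λ Q′ → (Q ─[ μ ]→ Q′) × SymClosure (SequentialParallel a) P′ Q′
  simulate (fwd aa,a∣a) pre = _ , parL pre , fwd a,0∣a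
  simulate (fwd a,0∣a) pre = _ , parR pre , fwd 0,0∣0
  simulate (fwd a,a∣0) pre = _ , parL pre , fwd 0,0∣0
  simulate (bwd aa,a∣a) (parL pre) = _ , pre , bwd a,0∣a
  simulate (bwd aa,a∣a) (parR pre) = _ , pre , bwd a,a∣0
  simulate (bwd aa,a∣a) (com pre ())
  simulate (bwd a,0∣a) (parR pre) = _ , pre , bwd 0,0∣0
  simulate (bwd a,0∣a) (com () _)
  simulate (bwd a,a∣0) (parL pre) = _ , pre , bwd 0,0∣0
  simulate (bwd a,a∣0) (com _ ())
  simulate (bwd 0,0∣0) (com () _)

nameOf : Prefix → Name
nameOf (nm a) = a
nameOf (co a) = a

maxName : Term → ℕ
maxName 𝟎ₜ = 0
maxName (η ∙ₜ M) = nameOf η ⊔ maxName M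
maxName (M ∣ₜ N) = maxName M ⊔ maxName N
maxName (var _) = 0

maxNameₑ : Equation → ℕ
maxNameₑ (M , N) = maxName M ⊔ maxName N

freshName : List Equation → Name
freshName ℰ = suc (max 0 (map maxNameₑ ℰ))

freshName-fresh : ∀ ℰ → All ((_< freshName ℰ) ∘ maxNameₑ) ℰ
freshName-fresh ℰ = All.map s≤s (map⁻ (xs≤max 0 (map maxNameₑ ℰ)))

module Observing (b : Name) where

  isβ : Prefix → Bool
  isβ (nm a) = a ≡ᵇ b
  isβ (co a) = false

  isβ-b : isβ (nm b) ≡ true
  isβ-b = to T-≡ (≡⇒≡ᵇ b b refl)

  isβ-fresh : ∀ η → nameOf η < b → isβ η ≡ false
  isβ-fresh (nm a) a<b = ¬-not (<⇒≢ a<b ∘ ≡ᵇ⇒≡ a b ∘ from T-≡)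
  isβ-fresh (co a) _ = refl

  β : Act
  β = vis (nm b)

  canβ : Proc → Bool
  canβ 𝟎 = false
  canβ (η ∙ P) = isβ η
  canβ (P ∣ Q) = canβ P ∨ canβ Q

  canββ : Proc → Bool
  canββ 𝟎 = false
  canββ (η ∙ P) = isβ η ∧ canβ P
  canββ (P ∣ Q) = canββ P ∨ canββ Q ∨ canβ P ∧ canβ Q

  canβ-sound : ∀ {P P′} → P ─[ β ]→ P′ → T (canβ P)
  canβ-sound pre = ≡⇒≡ᵇ b b refl
  canβ-sound (parL P→) = from T-∨ (inj₁ (canβ-sound P→))
  canβ-sound (parR Q→) = from T-∨ (inj₂ (canβ-sound Q→))

  canβ-complete : ∀ P → T (canβ P) → ∃ (P ─[ β ]→_)
  canβ-complete (nm a ∙ P) t with ≡ᵇ⇒≡ a b t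
  ... | refl = P , pre
  canβ-complete (P ∣ Q) t with to (T-∨ {canβ P}) t
  ... | inj₁ tP = let P′ , P→ = canβ-complete P tP in P′ ∣ Q , parL P→
  ... | inj₂ tQ = let Q′ , Q→ = canβ-complete Q tQ in P ∣ Q′ , parR Q→

  canββ-sound : ∀ {P P₁ P₂} → P ─[ β ]→ P₁ → P₁ ─[ β ]→ P₂ → T (canββ P)
  canββ-sound pre P₁→ = from T-∧ (≡⇒≡ᵇ b b refl , canβ-sound P₁→)
  canββ-sound (parL P→) (parL P₁→) = from T-∨ (inj₁ (canββ-sound P→ P₁→))
  canββ-sound {P ∣ Q} (parR Q→) (parR Q₁→) =
    from (T-∨ {canββ P}) (inj₂ (from T-∨ (inj₁ (canββ-sound Q→ Q₁→))))
  canββ-sound {P ∣ Q} (parL P→) (parR Q→) =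
    from (T-∨ {canββ P}) (inj₂ (from T-∨ (inj₂ (from T-∧ (canβ-sound P→ , canβ-sound Q→)))))
  canββ-sound {P ∣ Q} (parR Q→) (parL P→) =
    from (T-∨ {canββ P}) (inj₂ (from T-∨ (inj₂ (from T-∧ (canβ-sound P→ , canβ-sound Q→)))))

  canββ-complete : ∀ P → T (canββ P) → ∃₂ λ P₁ P₂ → (P ─[ β ]→ P₁) × (P₁ ─[ β ]→ P₂)
  canββ-complete (nm a ∙ P) t with to (T-∧ {a ≡ᵇ b}) t
  ... | ta , tP with ≡ᵇ⇒≡ a b ta
  ... | refl = let P₂ , P→ = canβ-complete P tP in P , P₂ , pre , P→
  canββ-complete (P ∣ Q) t with to (T-∨ {canββ P}) t
  ... | inj₁ tP = let P₁ , P₂ , P→ , P₁→ = canββ-complete P tP in P₁ ∣ Q , P₂ ∣ Q , parL P→ , parL P₁→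
  ... | inj₂ t′ with to (T-∨ {canββ Q}) t′
  ... | inj₁ tQ = let Q₁ , Q₂ , Q→ , Q₁→ = canββ-complete Q tQ in P ∣ Q₁ , P ∣ Q₂ , parR Q→ , parR Q₁→
  ... | inj₂ t″ with to (T-∧ {canβ P}) t″
  ... | tP , tQ = let P′ , P→ = canβ-complete P tP ; Q′ , Q→ = canβ-complete Q tQ in
                  P′ ∣ Q , P′ ∣ Q′ , parL P→ , parR Q→

  ∼⇒canβ : ∀ {P Q} → P ∼ Q → T (canβ P) → T (canβ Q)
  ∼⇒canβ (_ , (_ , simulate) , PRQ) tP =
    let _ , P→ = canβ-complete _ tP
        _ , Q→ , _ = simulate PRQ P→
    in canβ-sound Q→

  ∼⇒canββ : ∀ {P Q} → P ∼ Q → T (canββ P) → T (canββ Q)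
  ∼⇒canββ (_ , (_ , simulate) , PRQ) tP =
    let _ , _ , P→ , P₁→ = canββ-complete _ tP
        _ , Q→ , P₁RQ₁ = simulate PRQ P→
        _ , Q₁→ , _ = simulate P₁RQ₁ P₁→
    in canββ-sound Q→ Q₁→

  observe : Proc → Bool × Bool
  observe P = canβ P , canββ P

  ∼⇒observe≡ : ∀ {P Q} → P ∼ Q → observe P ≡ observe Q
  ∼⇒observe≡ P∼Q = cong₂ _,_ (T-injective (∼⇒canβ P∼Q) (∼⇒canβ (∼-sym P∼Q)))
                             (T-injective (∼⇒canββ P∼Q) (∼⇒canββ (∼-sym P∼Q)))

  observe-congruence : IsCongruence (_≡_ on observe)
  observe-congruence = record
    { isEquivalence = On.isEquivalence observe ≡.isEquivalence
    ; ∙-cong = λ η → cong λ (c , _) → isβ η , isβ η ∧ c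
    ; ∣-cong = cong₂ λ (c₁ , d₁) (c₂ , d₂) → c₁ ∨ c₂ , d₁ ∨ d₂ ∨ c₁ ∧ c₂
    }

  pad : Proc → Proc
  pad 𝟎 = 𝟎
  pad (η ∙ P) = if isβ η then η ∙ bar η ∙ pad P else η ∙ pad P
  pad (P ∣ Q) = pad P ∣ pad Q

  pad-congruence : ∀ {R} → IsCongruence R → IsCongruence (R on pad)
  pad-congruence {R} R-cong = record
    { isEquivalence = On.isEquivalence pad isEquivalence
    ; ∙-cong = pad-∙-cong
    ; ∣-cong = ∣-cong
    }
    where
    open IsCongruence R-cong
    pad-∙-cong : ∀ η {P Q} → R (pad P) (pad Q) → R (pad (η ∙ P)) (pad (η ∙ Q))
    pad-∙-cong η e with isβ η
    ... | true = ∙-cong η (∙-cong (bar η) e)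
    ... | false = ∙-cong η e

  pad-inst : ∀ M ρ → maxName M < b → pad (inst M ρ) ≡ inst M (pad ∘ ρ)
  pad-inst 𝟎ₜ ρ _ = refl
  pad-inst (η ∙ₜ M) ρ fresh rewrite isβ-fresh η (m⊔n<o⇒m<o _ _ fresh) =
    cong (η ∙_) (pad-inst M ρ (m⊔n<o⇒n<o _ _ fresh))
  pad-inst (M ∣ₜ N) ρ fresh =
    cong₂ _∣_ (pad-inst M ρ (m⊔n<o⇒m<o _ _ fresh)) (pad-inst N ρ (m⊔n<o⇒n<o _ _ fresh))
  pad-inst (var X) ρ _ = refl

  _≃_ : Rel
  _≃_ = (_≡_ on observe) on pad

  correct⇒⊨ : ∀ {e} → Correct e → maxNameₑ e < b → _≃_ ⊨ e
  correct⇒⊨ {M , N} M∼N fresh ρ = begin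
    observe (pad (inst M ρ))   ≡⟨ cong observe (pad-inst M ρ (m⊔n<o⇒m<o _ _ fresh)) ⟩
    observe (inst M (pad ∘ ρ)) ≡⟨ ∼⇒observe≡ (M∼N (pad ∘ ρ)) ⟩
    observe (inst N (pad ∘ ρ)) ≡⟨ cong observe (pad-inst N ρ (m⊔n<o⇒n<o _ _ fresh)) ⟨
    observe (pad (inst N ρ))   ∎
    where open ≡.≡-Reasoning

  -- b ≡ᵇ b does not reduce for a variable b, so padded b-prefixes are unfolded with this equation.
  pad-β : ∀ P → pad (nm b ∙ P) ≡ nm b ∙ co b ∙ pad P
  pad-β P rewrite isβ-b = refl

  b∙b̄-¬canββ : ∀ P → ¬ T (canββ (nm b ∙ co b ∙ P))
  b∙b̄-¬canββ P t with canββ-complete (nm b ∙ co b ∙ P) t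
  ... | _ , _ , pre , ()

  pad-b∣b-canββ : T (canββ (pad (nm b ∙ 𝟎 ∣ nm b ∙ 𝟎)))
  pad-b∣b-canββ = canββ-sound (parL b∙0→) (parR b∙0→)
    where
    b∙0→ : pad (nm b ∙ 𝟎) ─[ β ]→ (co b ∙ 𝟎)
    b∙0→ = ≡.subst (_─[ β ]→ (co b ∙ 𝟎)) (≡.sym (pad-β 𝟎)) pre

  pad-bb-¬canββ : ¬ T (canββ (pad (nm b ∙ nm b ∙ 𝟎)))
  pad-bb-¬canββ = b∙b̄-¬canββ (pad (nm b ∙ 𝟎)) ∘ ≡.subst (T ∘ canββ) (pad-β (nm b ∙ 𝟎))

  bb≄b∣b : ¬ ((nm b ∙ nm b ∙ 𝟎) ≃ (nm b ∙ 𝟎 ∣ nm b ∙ 𝟎))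
  bb≄b∣b eq = pad-bb-¬canββ (≡.subst T (cong proj₂ (≡.sym eq)) pad-b∣b-canββ)

  ⊬bb≈b∣b : ∀ {ℰ} → All Correct ℰ → All ((_< b) ∘ maxNameₑ) ℰ →
            ¬ (ℰ ⊢ ⌜ nm b ∙ nm b ∙ 𝟎 ⌝ ≈ ⌜ nm b ∙ 𝟎 ∣ nm b ∙ 𝟎 ⌝)
  ⊬bb≈b∣b correct fresh =
    bb≄b∣b ∘ ⊢-sound-ground (pad-congruence observe-congruence)
                            (All.zipWith (λ {e} → uncurry (correct⇒⊨ {e})) (correct , fresh))

theorem3p9 : (ℰ : List Equation) → All Correct ℰ →
    Σ Proc λ P → Σ Proc λ Q → (P ∼ Q) × ¬ (ℰ ⊢ ⌜ P ⌝ ≈ ⌜ Q ⌝)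
theorem3p9 ℰ correct =
  nm b ∙ nm b ∙ 𝟎 , nm b ∙ 𝟎 ∣ nm b ∙ 𝟎 , a∙a∼a∣a b , ⊬bb≈b∣b correct (freshName-fresh ℰ)
  where
  b : Name
  b = freshName ℰ
  open Observing b
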